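{- There is a $7$-cycle decomposition of $C_5[7]$ together with a $2$-colouring (red/blue) of its vertices which is equitable for the decomposition and in which each part has four red and three blue vertices.
   Context: $C_5[7]$ is the lexicographic product of the $5$-cycle with the empty graph $\overline{K_7}$: vertex set $\mathbb{Z}_5\times\{1,\dots,7\}$, with $(a,h)$ adjacent to $(a',h')$ iff $a-a'=\pm1$; its parts are the sets $\{a\}\times\{1,\dots,7\}$. A $2$-colouring is equitable for a $7$-cycle decomposition if each cycle has $3$ or $4$ vertices of each colour. -}

module Defs where

open import Data.Nat using (ℕ; zero; suc; _+_; _≤_)
open import Data.Fin using (Fin; toℕ; zero; suc)
open import Data.Fin.Properties using () renaming (_≟_ to _≟F_)
open import Data.Product using (_×_; _,_; proj₁; proj₂; Σ; ∃)
open import Data.Sum using (_⊎_)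
open import Data.Bool using (Bool; true; false; _∧_; _∨_; if_then_else_)
open import Data.List using (List; map; allFin)
open import Data.Nat.ListAction using (sum)
open import Data.List.Relation.Unary.All using (All)
open import Data.Product.Properties using (≡-dec)
open import Relation.Binary.Definitions using (DecidableEquality)
open import Data.Vec using (Vec; lookup)
open import Relation.Binary.PropositionalEquality using (_≡_; _≢_)
open import Relation.Nullary using (Dec; yes; no)
open import Relation.Nullary.Decidable using (⌊_⌋)
open import Data.Nat.DivMod using (_%_)

Vertex : Set
Vertex = Fin 5 × Fin 7

Adj : Vertex → Vertex → Set
Adj (a , h) (a' , h') =
  ((toℕ a + 1) % 5 ≡ toℕ a') ⊎ ((toℕ a' + 1) % 5 ≡ toℕ a)

next : Fin 7 → Fin 7
next zero = suc zero
next (suc zero) = suc (suc zero)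
next (suc (suc zero)) = suc (suc (suc zero))
next (suc (suc (suc zero))) = suc (suc (suc (suc zero)))
next (suc (suc (suc (suc zero)))) = suc (suc (suc (suc (suc zero))))
next (suc (suc (suc (suc (suc zero))))) = suc (suc (suc (suc (suc (suc zero)))))
next (suc (suc (suc (suc (suc (suc zero)))))) = zero

record Cycle7 : Set where
  field
    verts    : Vec Vertex 7
    distinct : ∀ i j → lookup verts i ≡ lookup verts j → i ≡ j
    adjacent : ∀ i → Adj (lookup verts i) (lookup verts (next i))
open Cycle7 public

_≟V_ : DecidableEquality Vertex
_≟V_ = ≡-dec _≟F_ _≟F_

edgeIs : Cycle7 → Fin 7 → Vertex → Vertex → Bool
edgeIs C i u v =
  (⌊ lookup (verts C) i ≟V u ⌋ ∧ ⌊ lookup (verts C) (next i) ≟V v ⌋) ∨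
  (⌊ lookup (verts C) i ≟V v ⌋ ∧ ⌊ lookup (verts C) (next i) ≟V u ⌋)

edgeCount : Cycle7 → Vertex → Vertex → ℕ
edgeCount C u v = sum (map (λ i → if edgeIs C i u v then 1 else 0) (allFin 7))

-- A 7-cycle decomposition of C₅[7]: a collection of 7-cycles of C₅[7]
-- such that every edge of C₅[7] lies in exactly one of the cycles
-- (cycles are automatically subgraphs, by Cycle7.adjacent).
IsDecomposition : List Cycle7 → Set
IsDecomposition D =
  ∀ u v → Adj u v → sum (map (λ C → edgeCount C u v) D) ≡ 1

-- 2-colourings: true = red, false = blue.
Colouring : Set
Colouring = Vertex → Bool

redCount : Colouring → Cycle7 → ℕ
redCount col C = sum (map (λ i → if col (lookup (verts C) i) then 1 else 0) (allFin 7))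

-- Equitable: each cycle has 3 or 4 vertices of each colour,
-- i.e. 3 or 4 red vertices (the remaining 7 - r are blue).
Equitable : Colouring → List Cycle7 → Set
Equitable col D = All (λ C → (redCount col C ≡ 3) ⊎ (redCount col C ≡ 4)) D

partRed : Colouring → Fin 5 → ℕ
partRed col a = sum (map (λ h → if col (a , h) then 1 else 0) (allFin 7))

{-# OPTIONS --safe #-}
-- The decomposition is cyclic: seven base cycles, each starting in part 0
-- or 1, are developed under the rotation (a , h) ↦ (a + 1 , h) of C₅[7],
-- an automorphism, giving 35 cycles; that these cover every one of the
-- 5 · 49 = 245 edges exactly once is a finite check. Colouring the
-- vertices with h ∈ {0,1,2,3} red makes every part 4-red, and since this
-- colouring is invariant under the rotation, equitability has to be
-- checked on the base cycles only.
module Submission where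

open import Defs
open import Data.Nat using (zero; suc; _+_; _<ᵇ_) renaming (_≟_ to _≟ℕ_)
open import Data.Nat.DivMod using (_%_; m%n<n)
open import Data.Nat.ListAction using (sum)
open import Data.Bool using (if_then_else_)
open import Data.Fin using (Fin; toℕ; fromℕ<; #_)
open import Data.Fin.Properties using (all?) renaming (_≟_ to _≟F_)
open import Data.List using (List; []; _∷_; map; iterate; concatMap; allFin)
open import Data.List.Properties using (map-cong)
open import Data.List.Relation.Unary.All as All using (All; []; _∷_)
open import Data.List.Relation.Unary.All.Properties using (concat⁺; map⁺)
open import Data.Vec as Vec using (Vec; lookup; []; _∷_)
open import Data.Vec.Properties using (lookup-map)
open import Data.Product using (Σ; _×_; _,_)
open import Data.Product.Properties using (,-injectiveˡ; ,-injectiveʳ)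
open import Data.Sum using (_⊎_)
open import Relation.Binary.PropositionalEquality
  using (_≡_; refl; sym; trans; cong; cong₂; subst₂)
open import Relation.Nullary using (Dec)
open import Relation.Nullary.Decidable
  using (True; toWitness; map′; _→-dec_; _⊎-dec_)

adj? : ∀ u v → Dec (Adj u v)
adj? (a , _) (a' , _) = ((toℕ a + 1) % 5 ≟ℕ toℕ a') ⊎-dec ((toℕ a' + 1) % 5 ≟ℕ toℕ a)

isDecomposition? : (D : List Cycle7) → Dec (IsDecomposition D)
isDecomposition? D =
  map′ (λ f (a , h) (a' , h') → f a h a' h') (λ f a h a' h' → f (a , h) (a' , h'))
    (all? λ a → all? λ h → all? λ a' → all? λ h' →
      adj? (a , h) (a' , h') →-dec (sum (map (λ C → edgeCount C (a , h) (a' , h')) D) ≟ℕ 1))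

cycle7 : (v : Vec Vertex 7) →
         {True (all? λ i → all? λ j → (lookup v i ≟V lookup v j) →-dec (i ≟F j))} →
         {True (all? λ i → adj? (lookup v i) (lookup v (next i)))} → Cycle7
cycle7 v {d} {a} = record { verts = v ; distinct = toWitness d ; adjacent = toWitness a }

succ₅ : Fin 5 → Fin 5
succ₅ a = fromℕ< (m%n<n (toℕ a + 1) 5)

rotate : Vertex → Vertex
rotate (a , h) = (succ₅ a , h)

rotate-injective : ∀ {u v} → rotate u ≡ rotate v → u ≡ v
rotate-injective {a , _} {b , _} eq = cong₂ _,_ (succ₅-injective (,-injectiveˡ eq)) (,-injectiveʳ eq)
  where
  succ₅-injective : succ₅ a ≡ succ₅ b → a ≡ b
  succ₅-injective =
    toWitness {a? = all? λ a → all? λ b → (succ₅ a ≟F succ₅ b) →-dec (a ≟F b)} _ a b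

-- Adj ignores the second coordinates, so checking it with h = h' = 0 suffices.
rotate-Adj : ∀ u v → Adj u v → Adj (rotate u) (rotate v)
rotate-Adj (a , _) (a' , _) =
  toWitness {a? = all? λ a → all? λ a' →
                    adj? (a , # 0) (a' , # 0) →-dec adj? (rotate (a , # 0)) (rotate (a' , # 0))} _ a a'

rotateCycle : Cycle7 → Cycle7
rotateCycle C = record
  { verts    = Vec.map rotate (verts C)
  ; distinct = λ i j eq → distinct C i j (rotate-injective
                 (trans (sym (lookup-map i rotate (verts C))) (trans eq (lookup-map j rotate (verts C)))))
  ; adjacent = λ i → subst₂ Adj (sym (lookup-map i rotate (verts C))) (sym (lookup-map (next i) rotate (verts C)))
                 (rotate-Adj (lookup (verts C) i) (lookup (verts C) (next i)) (adjacent C i))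
  }

orbit : Cycle7 → List Cycle7
orbit C = iterate rotateCycle C 5

RotationInvariant : Colouring → Set
RotationInvariant col = ∀ v → col (rotate v) ≡ col v

redCount-rotateCycle : ∀ {col} → RotationInvariant col →
                       ∀ C → redCount col (rotateCycle C) ≡ redCount col C
redCount-rotateCycle {col} invariant C = cong sum (map-cong red-at (allFin 7))
  where
  red-at : ∀ i → (if col (lookup (Vec.map rotate (verts C)) i) then 1 else 0)
                ≡ (if col (lookup (verts C) i) then 1 else 0)
  red-at i = cong (λ b → if b then 1 else 0)
                  (trans (cong col (lookup-map i rotate (verts C))) (invariant (lookup (verts C) i)))

Balanced : Colouring → Cycle7 → Set
Balanced col C = (redCount col C ≡ 3) ⊎ (redCount col C ≡ 4)

balanced? : ∀ col C → Dec (Balanced col C)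
balanced? col C = (redCount col C ≟ℕ 3) ⊎-dec (redCount col C ≟ℕ 4)

Balanced-rotateCycle : ∀ {col} → RotationInvariant col →
                       ∀ C → Balanced col C → Balanced col (rotateCycle C)
Balanced-rotateCycle invariant C rewrite redCount-rotateCycle invariant C = λ b → b

All-iterate : ∀ {A : Set} {P : A → Set} {f : A → A} →
              (∀ x → P x → P (f x)) → ∀ {x} → P x → ∀ n → All P (iterate f x n)
All-iterate step px zero    = []
All-iterate step px (suc n) = px ∷ All-iterate step (step _ px) n

Equitable-concatMap-orbit : ∀ {col} → RotationInvariant col →
                            ∀ D → Equitable col D → Equitable col (concatMap orbit D)
Equitable-concatMap-orbit {col} invariant D equitable =
  concat⁺ (map⁺ {f = orbit}
    (All.map (λ b → All-iterate {P = Balanced col} {f = rotateCycle} (Balanced-rotateCycle invariant) b 5)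
             equitable))

baseCycles : List Cycle7
baseCycles =
  cycle7 ((# 0 , # 0) ∷ (# 1 , # 0) ∷ (# 0 , # 2) ∷ (# 1 , # 3) ∷ (# 2 , # 6) ∷ (# 3 , # 6) ∷ (# 4 , # 5) ∷ []) ∷
  cycle7 ((# 0 , # 0) ∷ (# 1 , # 1) ∷ (# 0 , # 3) ∷ (# 1 , # 0) ∷ (# 2 , # 4) ∷ (# 3 , # 5) ∷ (# 4 , # 6) ∷ []) ∷
  cycle7 ((# 0 , # 0) ∷ (# 1 , # 2) ∷ (# 0 , # 3) ∷ (# 1 , # 4) ∷ (# 2 , # 6) ∷ (# 3 , # 2) ∷ (# 4 , # 4) ∷ []) ∷
  cycle7 ((# 0 , # 0) ∷ (# 1 , # 3) ∷ (# 2 , # 3) ∷ (# 3 , # 5) ∷ (# 4 , # 5) ∷ (# 0 , # 4) ∷ (# 4 , # 1) ∷ []) ∷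
  cycle7 ((# 0 , # 0) ∷ (# 1 , # 5) ∷ (# 2 , # 2) ∷ (# 3 , # 2) ∷ (# 4 , # 5) ∷ (# 0 , # 1) ∷ (# 1 , # 6) ∷ []) ∷
  cycle7 ((# 0 , # 1) ∷ (# 1 , # 1) ∷ (# 2 , # 3) ∷ (# 1 , # 6) ∷ (# 2 , # 4) ∷ (# 3 , # 4) ∷ (# 4 , # 2) ∷ []) ∷
  cycle7 ((# 0 , # 1) ∷ (# 1 , # 2) ∷ (# 2 , # 6) ∷ (# 3 , # 1) ∷ (# 4 , # 5) ∷ (# 0 , # 3) ∷ (# 4 , # 4) ∷ []) ∷
  []

decomposition : List Cycle7
decomposition = concatMap orbit baseCycles

colouring : Colouring
colouring (_ , h) = toℕ h <ᵇ 4

decomposition-isDecomposition : IsDecomposition decomposition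
decomposition-isDecomposition = toWitness {a? = isDecomposition? decomposition} _

decomposition-equitable : Equitable colouring decomposition
decomposition-equitable =
  Equitable-concatMap-orbit {colouring} (λ _ → refl) baseCycles
    (toWitness {a? = All.all? (balanced? colouring) baseCycles} _)

lemma9 : Σ (List Cycle7) λ D → Σ Colouring λ col →
           IsDecomposition D × Equitable col D × ((a : Fin 5) → partRed col a ≡ 4)
lemma9 = decomposition , colouring , decomposition-isDecomposition , decomposition-equitable , λ _ → refl
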